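{- Let $D$ be a finite connected digraph with $\chi(D)=5$, not isomorphic to $T_5$, in which every vertex has out-degree at least $2$, such that $D$ contains no copy of $p_4$ and the underlying graph of $D$ contains no $K_5$. Let $D'$ be a $5$-critical subdigraph of $D$ and let $D^o$ be the subdigraph of $D'$ induced by the vertices whose out-degree in $D'$ is at least $3$. Then every vertex $v$ of $D^o$ has in-degree at most $1$ in $D^o$.
   Context: A digraph has no loops and, for any two vertices $x,y$, at most one of the arcs $(x,y),(y,x)$; $\chi$ is the chromatic number of the underlying (unoriented) graph. $T_5$ is the $5$-vertex tournament in which every vertex has in- and out-degree $2$. $p_4$ is the digraph with vertices $x,y,z,v,w$ and arcs $y\to x$, $y\to z$, $v\to z$, $v\to w$; a copy of $H$ in $D$ is the image of an injective arc-preserving map $V(H)\to V(D)$. A subdigraph $D'$ is $5$-critical if $\chi(D')=5$ and $\chi(D'-u)<5$ for every vertex $u$ of $D'$. -}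

module Defs where

open import Data.Nat using (ℕ; zero; suc; _+_; _∸_; _≤_; _<_; _≡ᵇ_; _%_)
open import Data.Bool using (Bool; true; false; _∧_; _∨_; not; T)
open import Data.Fin using (Fin; toℕ; zero; suc)
open import Data.List using (List; length; filterᵇ; allFin)
open import Data.Product using (Σ; _×_; _,_)
open import Data.Sum using (_⊎_)
open import Data.Empty using (⊥)
open import Relation.Nullary using (¬_)
open import Relation.Binary.PropositionalEquality using (_≡_; _≢_)
open import Function.Definitions using (Injective; Bijective)

record Digraph (n : ℕ) : Set where
  field
    arc       : Fin n → Fin n → Bool
    loopless  : ∀ x → arc x x ≡ false
    oriented  : ∀ x y → T (arc x y) → T (arc y x) → ⊥
open Digraph public

count : ∀ {n} → (Fin n → Bool) → ℕ
count {n} p = length (filterᵇ p (allFin n))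

adj : ∀ {n} → Digraph n → Fin n → Fin n → Bool
adj D x y = arc D x y ∨ arc D y x

outdeg : ∀ {n} → Digraph n → Fin n → ℕ
outdeg D v = count (λ y → arc D v y)

data Walk {n} (D : Digraph n) : Fin n → Fin n → Set where
  here : ∀ {x} → Walk D x x
  step : ∀ {x y z} → T (adj D x y) → Walk D y z → Walk D x z

Connected : ∀ {n} → Digraph n → Set
Connected {n} D = ∀ (x y : Fin n) → Walk D x y

record SubDigraph {n} (D : Digraph n) : Set where
  field
    vtx      : Fin n → Bool
    sarc     : Fin n → Fin n → Bool
    sarc⊆arc : ∀ x y → T (sarc x y) → T (arc D x y)
    sarc-src : ∀ x y → T (sarc x y) → T (vtx x)
    sarc-tgt : ∀ x y → T (sarc x y) → T (vtx y)
open SubDigraph public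

-- a proper k-colouring of the underlying graph of the subdigraph with
-- vertex set `S` and arcs `B` (colours of vertices outside S are irrelevant)
Colourable : ∀ {n} → (S : Fin n → Bool) → (B : Fin n → Fin n → Bool) → ℕ → Set
Colourable {n} S B k =
  Σ (Fin n → Fin k) λ c → ∀ x y → T (S x) → T (S y) → T (B x y ∨ B y x) → c x ≢ c y

HasChromaticNumber : ∀ {n} → (Fin n → Bool) → (Fin n → Fin n → Bool) → ℕ → Set
HasChromaticNumber S B k = Colourable S B k × ¬ Colourable S B (k ∸ 1)

χ≡ : ∀ {n} → Digraph n → ℕ → Set
χ≡ D k = HasChromaticNumber (λ _ → true) (arc D) k

minus : ∀ {n} → (Fin n → Bool) → Fin n → (Fin n → Bool)
minus S u x = S x ∧ not (toℕ x ≡ᵇ toℕ u)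

-- D' is 5-critical: χ(D') = 5 and χ(D' - u) < 5 for every vertex u of D'
-- (χ(D'-u) < 5 is equivalent to D'-u being 4-colourable).
FiveCritical : ∀ {n} {D : Digraph n} → SubDigraph D → Set
FiveCritical {n} D' =
  HasChromaticNumber (vtx D') (sarc D') 5 ×
  (∀ (u : Fin n) → T (vtx D' u) → Colourable (minus (vtx D') u) (sarc D') 4)

soutdeg : ∀ {n} {D : Digraph n} → SubDigraph D → Fin n → ℕ
soutdeg D' v = count (λ y → sarc D' v y)

-- T5: vertices Z/5, arcs i → i+1 and i → i+2
t5arc : Fin 5 → Fin 5 → Bool
t5arc i j = let d = (toℕ j + 5 ∸ toℕ i) % 5 in (d ≡ᵇ 1) ∨ (d ≡ᵇ 2)

IsoTo : ∀ {n m} → Digraph n → (Fin m → Fin m → Bool) → Set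
IsoTo {n} {m} D E =
  Σ (Fin n → Fin m) λ f → Bijective _≡_ _≡_ f × (∀ x y → arc D x y ≡ E (f x) (f y))

IsoToT5 : ∀ {n} → Digraph n → Set
IsoToT5 D = IsoTo D t5arc

-- p4 on vertices x,y,z,v,w = 0,1,2,3,4 with arcs y→x, y→z, v→z, v→w.
-- A copy of p4 in D: injective map sending arcs to arcs.
CopyOfP4 : ∀ {n} → Digraph n → Set
CopyOfP4 {n} D =
  Σ (Fin 5 → Fin n) λ f → Injective _≡_ _≡_ f ×
    (T (arc D (f (suc zero)) (f zero)) ×
     T (arc D (f (suc zero)) (f (suc (suc zero)))) ×
     T (arc D (f (suc (suc (suc zero)))) (f (suc (suc zero)))) ×
     T (arc D (f (suc (suc (suc zero)))) (f (suc (suc (suc (suc zero)))))))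

HasK5 : ∀ {n} → Digraph n → Set
HasK5 {n} D =
  Σ (Fin 5 → Fin n) λ f → Injective _≡_ _≡_ f ×
    (∀ i j → i ≢ j → T (adj D (f i) (f j)))

inDo : ∀ {n} {D : Digraph n} → SubDigraph D → Fin n → Bool
inDo D' v = vtx D' v ∧ (3 Data.Nat.≤ᵇ soutdeg D' v)

indegDo : ∀ {n} {D : Digraph n} → SubDigraph D → Fin n → ℕ
indegDo D' v = count (λ u → inDo D' u ∧ sarc D' u v)

-- Only p4-freeness matters.  If two distinct vertices a, b of D° both send an
-- arc of D' to v, the orientation lets us assume there is no arc a → b.  Since
-- a and b have out-degree at least 3 in D', b has an out-neighbour w ∉ {v, a}
-- and a has one x ∉ {v, w}; then x ← a → v ← b → w is a copy of p4.

module Submission where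

open import Defs
open import Data.Nat using (ℕ; zero; suc; _≤_; _<_; _≡ᵇ_; s≤s; _≤?_)
open import Data.Nat.Properties
  using (≤-refl; ≤-trans; ≤-pred; n≤1+n; <⇒≤; ≰⇒>; ≤ᵇ⇒≤; ≡⇒≡ᵇ; module ≤-Reasoning)
open import Data.Bool using (Bool; true; false; T; if_then_else_; _∧_)
open import Data.Bool.Properties using (T-∧)
open import Data.Fin using (Fin; zero; suc; toℕ)
open import Data.List using (List; []; _∷_; length; filterᵇ; tabulate; lookup)
open import Data.List.Relation.Unary.All as All using (All; []; _∷_)
open import Data.List.Relation.Unary.AllPairs using ([]; _∷_)
open import Data.List.Relation.Unary.Unique.Propositional using (Unique)
open import Data.List.Membership.Propositional.Properties using (∈-lookup)
open import Data.Product using (∃; _×_; _,_; proj₂)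
open import Data.Empty using (⊥-elim)
open import Data.Unit using (tt)
open import Function using (_∘_; Equivalence)
open import Function.Definitions using (Injective)
open import Relation.Nullary using (¬_; yes; no)
open import Relation.Binary.PropositionalEquality
  using (_≡_; _≢_; refl; sym; trans; cong; subst; ≢-sym)

private
  variable
    n : ℕ

count-tabulate : {A : Set} (p : A → Bool) (f : Fin n → A) →
                 length (filterᵇ p (tabulate f)) ≡ count (p ∘ f)
count-tabulate {n = zero}  p f = refl
count-tabulate {n = suc n} p f with p (f zero)
... | true  = cong suc (trans (count-tabulate p (f ∘ suc)) (sym (count-tabulate (p ∘ f) suc)))
... | false = trans (count-tabulate p (f ∘ suc)) (sym (count-tabulate (p ∘ f) suc))

count-suc : (p : Fin (suc n) → Bool) →
            count p ≡ (if p zero then suc (count (p ∘ suc)) else count (p ∘ suc))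
count-suc p with p zero
... | true  = cong suc (count-tabulate p suc)
... | false = count-tabulate p suc

count-witness : (p : Fin n → Bool) → 0 < count p → ∃ λ x → T (p x)
count-witness {suc n} p pos with p zero in eq | count-suc p
... | true  | _  = zero , subst T (sym eq) tt
... | false | eq′ with x , px ← count-witness (p ∘ suc) (subst (0 <_) eq′ pos) = suc x , px

-- Comparing toℕ's with _≡ᵇ_ makes `without p (suc a) ∘ suc` reduce to `without (p ∘ suc) a`.
without : (Fin n → Bool) → Fin n → Fin n → Bool
without p a x = if toℕ x ≡ᵇ toℕ a then false else p x

T-without : (p : Fin n → Bool) (a x : Fin n) → T (without p a x) → T (p x) × x ≢ a
T-without p a x t with toℕ x ≡ᵇ toℕ a in eq
... | false = t , λ { refl → subst T eq (≡⇒≡ᵇ (toℕ x) (toℕ x) refl) }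

if≤suc : ∀ b m → (if b then suc m else m) ≤ suc m
if≤suc true  m = ≤-refl
if≤suc false m = n≤1+n m

count≤suc-count-without : (p : Fin n → Bool) (a : Fin n) → count p ≤ suc (count (without p a))
count≤suc-count-without {suc n} p zero = begin
  count p                                                   ≡⟨ count-suc p ⟩
  (if p zero then suc (count (p ∘ suc)) else count (p ∘ suc)) ≤⟨ if≤suc (p zero) _ ⟩
  suc (count (p ∘ suc))                                     ≡⟨ cong suc (count-suc (without p zero)) ⟨
  suc (count (without p zero))                              ∎
  where open ≤-Reasoning
count≤suc-count-without {suc n} p (suc a)
  rewrite count-suc p | count-suc (without p (suc a)) with p zero
... | true  = s≤s (count≤suc-count-without (p ∘ suc) a)
... | false = count≤suc-count-without (p ∘ suc) a

∃-avoiding : (p : Fin n → Bool) (as : List (Fin n)) → length as < count p →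
             ∃ λ x → T (p x) × All (x ≢_) as
∃-avoiding p []       pos = let x , px = count-witness p pos in x , px , []
∃-avoiding p (a ∷ as) lt
  with x , px′ , x∉as ← ∃-avoiding (without p a) as
                           (≤-pred (≤-trans lt (count≤suc-count-without p a)))
  with px , x≢a ← T-without p a x px′
  = x , px , x≢a ∷ x∉as

lookup-injective : {A : Set} {xs : List A} → Unique xs → Injective _≡_ _≡_ (lookup xs)
lookup-injective {xs = x ∷ xs} (x∉xs ∷ u) {zero}  {zero}  e = refl
lookup-injective {xs = x ∷ xs} (x∉xs ∷ u) {zero}  {suc j} e = ⊥-elim (All.lookup x∉xs (∈-lookup j) e)
lookup-injective {xs = x ∷ xs} (x∉xs ∷ u) {suc i} {zero}  e = ⊥-elim (All.lookup x∉xs (∈-lookup i) (sym e))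
lookup-injective {xs = x ∷ xs} (x∉xs ∷ u) {suc i} {suc j} e = cong suc (lookup-injective u e)

arc⇒≢ : (D : Digraph n) {x y : Fin n} → T (arc D x y) → x ≢ y
arc⇒≢ D {x} x→y refl = subst T (loopless D x) x→y

copyOfP4 : (D : Digraph n) {x y z v w : Fin n} → Unique (x ∷ y ∷ z ∷ v ∷ w ∷ []) →
           T (arc D y x) → T (arc D y z) → T (arc D v z) → T (arc D v w) → CopyOfP4 D
copyOfP4 D {x} {y} {z} {v} {w} distinct y→x y→z v→z v→w =
  lookup (x ∷ y ∷ z ∷ v ∷ w ∷ []) , lookup-injective distinct , y→x , y→z , v→z , v→w

copyOfP4-at-common-head : {D : Digraph n} (D' : SubDigraph D) {a b v : Fin n} →
  3 ≤ soutdeg D' a → 3 ≤ soutdeg D' b → T (sarc D' a v) → T (sarc D' b v) →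
  a ≢ b → ¬ T (arc D a b) → CopyOfP4 D
copyOfP4-at-common-head {D = D} D' {a} {b} {v} deg-a deg-b a→v b→v a≢b a↛b
  with w , b→w , w≢v ∷ w≢a ∷ [] ← ∃-avoiding (sarc D' b) (v ∷ a ∷ []) deg-b
  with x , a→x , x≢v ∷ x≢w ∷ [] ← ∃-avoiding (sarc D' a) (v ∷ w ∷ []) deg-a
  = copyOfP4 D distinct (in-D a→x) (in-D a→v) (in-D b→v) (in-D b→w)
  where
    in-D : ∀ {s t} → T (sarc D' s t) → T (arc D s t)
    in-D = sarc⊆arc D' _ _

    x≢b : x ≢ b
    x≢b refl = a↛b (in-D a→x)

    distinct : Unique (x ∷ a ∷ v ∷ b ∷ w ∷ [])
    distinct = (≢-sym (arc⇒≢ D (in-D a→x)) ∷ x≢v ∷ x≢b ∷ x≢w ∷ [])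
             ∷ (arc⇒≢ D (in-D a→v) ∷ a≢b ∷ ≢-sym w≢a ∷ [])
             ∷ (≢-sym (arc⇒≢ D (in-D b→v)) ∷ ≢-sym w≢v ∷ [])
             ∷ (arc⇒≢ D (in-D b→w) ∷ [])
             ∷ [] ∷ []

inDo⇒3≤soutdeg : {D : Digraph n} (D' : SubDigraph D) {a : Fin n} → T (inDo D' a) → 3 ≤ soutdeg D' a
inDo⇒3≤soutdeg D' a∈D° = ≤ᵇ⇒≤ 3 _ (proj₂ (Equivalence.to T-∧ a∈D°))

copyOfP4-at-common-D°-head : {D : Digraph n} (D' : SubDigraph D) {a b v : Fin n} →
  T (inDo D' a) → T (inDo D' b) → T (sarc D' a v) → T (sarc D' b v) → a ≢ b → CopyOfP4 D
copyOfP4-at-common-D°-head {D = D} D' {a} {b} a∈D° b∈D° a→v b→v a≢b with arc D a b in a→b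
... | false = copyOfP4-at-common-head D' (inDo⇒3≤soutdeg D' a∈D°) (inDo⇒3≤soutdeg D' b∈D°)
                a→v b→v a≢b (subst T a→b)
... | true  = copyOfP4-at-common-head D' (inDo⇒3≤soutdeg D' b∈D°) (inDo⇒3≤soutdeg D' a∈D°)
                b→v a→v (≢-sym a≢b) (oriented D a b (subst T (sym a→b) tt))

D°-in-neighbour : {D : Digraph n} → SubDigraph D → Fin n → Fin n → Bool
D°-in-neighbour D' v u = inDo D' u ∧ sarc D' u v

p4-free⇒indegDo≤1 : {D : Digraph n} → ¬ CopyOfP4 D → (D' : SubDigraph D) (v : Fin n) →
                    indegDo D' v ≤ 1
p4-free⇒indegDo≤1 p4-free D' v with indegDo D' v ≤? 1
... | yes ≤1 = ≤1
... | no ≰1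
  with u₁ , u₁∈N , [] ← ∃-avoiding (D°-in-neighbour D' v) [] (<⇒≤ (≰⇒> ≰1))
  with u₂ , u₂∈N , u₂≢u₁ ∷ [] ← ∃-avoiding (D°-in-neighbour D' v) (u₁ ∷ []) (≰⇒> ≰1)
  with u₁∈D° , u₁→v ← Equivalence.to T-∧ u₁∈N
  with u₂∈D° , u₂→v ← Equivalence.to T-∧ u₂∈N
  = ⊥-elim (p4-free (copyOfP4-at-common-D°-head D' u₁∈D° u₂∈D° u₁→v u₂→v (≢-sym u₂≢u₁)))

corollary2p9 : ∀ (n : ℕ) (D : Digraph n) →
    Connected D →
    χ≡ D 5 →
    ¬ IsoToT5 D →
    (∀ v → 2 ≤ outdeg D v) →
    ¬ CopyOfP4 D →
    ¬ HasK5 D →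
    ∀ (D' : SubDigraph D) → FiveCritical D' →
    ∀ (v : Fin n) → T (inDo D' v) → indegDo D' v ≤ 1
corollary2p9 n D _ _ _ _ p4-free _ D' _ v _ = p4-free⇒indegDo≤1 p4-free D' v
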